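{- Work in intensional Martin-Löf type theory with dependent sums, dependent products, intensional identity types and a cumulative hierarchy of universes $U_0 : U_1 : U_2 : \cdots$, assuming function extensionality at all universe levels. Fix a universe level $i$. The following are logically equivalent: (a) There exist terms $\mathit{unit} : \prod_{A : U_i} \big(A = \sum_{a : A} 1\big)$, $\mathit{flip} : \prod_{A, B : U_i}\prod_{C : A \to B \to U_i} \big(\sum_{a:A}\sum_{b:B} C\,a\,b = \sum_{b:B}\sum_{a:A} C\,a\,b\big)$, and $\mathit{contract} : \prod_{A : U_i} \big(\mathit{isContr}(A) \to A = 1\big)$. (b) The type $\mathit{UA}_i \triangleq \prod_{A, B : U_i} (A \simeq B) \to A = B$ is inhabited.
   Context: $=$ denotes the identity type and $1$ the unit type. Function extensionality: for all $A$, $B : A \to U_j$ and $f,g : \prod_{x:A}B(x)$ there is a map $(\prod_{x:A} f(x) = g(x)) \to f = g$. $\mathit{isContr}(A) \triangleq \sum_{a_0 : A}\prod_{a:A}(a_0 = a)$. For $f : A \to B$ and $b : B$, $\mathit{fib}_f(b) \triangleq \sum_{a:A}(f\,a = b)$; $\mathit{isEquiv}(f) \triangleq \prod_{b:B}\mathit{isContr}(\mathit{fib}_f(b))$; and $A \simeq B \triangleq \sum_{f : A \to B}\mathit{isEquiv}(f)$. -}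

{-# OPTIONS --without-K #-}
module Defs where

open import Level using (Level; _⊔_) renaming (suc to lsuc)
open import Data.Product using (Σ; Σ-syntax; _×_)
open import Data.Unit.Polymorphic using (⊤)
open import Relation.Binary.PropositionalEquality using (_≡_)

isContr : ∀ {ℓ} → Set ℓ → Set ℓ
isContr A = Σ A λ a₀ → (a : A) → a₀ ≡ a

fib : ∀ {a b} {A : Set a} {B : Set b} → (A → B) → B → Set (a ⊔ b)
fib {A = A} f y = Σ A λ x → f x ≡ y

isEquiv : ∀ {a b} {A : Set a} {B : Set b} → (A → B) → Set (a ⊔ b)
isEquiv {B = B} f = (y : B) → isContr (fib f y)

_≃_ : ∀ {a b} → Set a → Set b → Set (a ⊔ b)
A ≃ B = Σ (A → B) isEquiv

UnitAx : (i : Level) → Set (lsuc i)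
UnitAx i = (A : Set i) → A ≡ (Σ A λ _ → ⊤ {i})

FlipAx : (i : Level) → Set (lsuc i)
FlipAx i = (A B : Set i) (C : A → B → Set i) →
  (Σ A λ a → Σ B λ b → C a b) ≡ (Σ B λ b → Σ A λ a → C a b)

ContractAx : (i : Level) → Set (lsuc i)
ContractAx i = (A : Set i) → isContr A → A ≡ ⊤ {i}

UA : (i : Level) → Set (lsuc i)
UA i = (A B : Set i) → A ≃ B → A ≡ B

{-# OPTIONS --without-K #-}

-- Each of unit, flip and contract identifies two types between which there is an
-- evident equivalence, so univalence provides all three. Conversely, for an
-- equivalence f : A → B the three axioms yield the chain of identities
--   A = Σ a 1 = Σ a Σ b (f a = b) = Σ b Σ a (f a = b) = Σ b 1 = B,
-- contracting the singletons Σ b (f a = b) in the second step and the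
-- fibres of f in the fourth.
module Submission where

open import Defs
open import Level using (Level) renaming (suc to lsuc)
open import Data.Product using (_×_; Σ; _,_; proj₁)
open import Function.Bundles using (_⇔_; mk⇔)
open import Axiom.Extensionality.Propositional using (Extensionality)
open import Data.Unit.Polymorphic using (⊤; tt)
open import Relation.Binary.PropositionalEquality using (_≡_; refl; sym; cong; module ≡-Reasoning)

singleton-isContr : ∀ {a} {A : Set a} (x : A) → isContr (Σ A (x ≡_))
singleton-isContr x = (x , refl) , λ { (_ , refl) → refl }

≃-Σ⊤ : ∀ {a ℓ} (A : Set a) → A ≃ Σ A (λ _ → ⊤ {ℓ})
≃-Σ⊤ A = (λ x → x , tt) , λ y → (proj₁ y , refl) , λ { (_ , refl) → refl }

Σ-swap-≃ : ∀ {a b c} (A : Set a) (B : Set b) (C : A → B → Set c) →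
  (Σ A λ x → Σ B λ y → C x y) ≃ (Σ B λ y → Σ A λ x → C x y)
Σ-swap-≃ A B C = swap , λ w → (unswap w , refl) , λ { (_ , refl) → refl }
  where
  swap : (Σ A λ x → Σ B λ y → C x y) → (Σ B λ y → Σ A λ x → C x y)
  swap (x , y , z) = y , x , z
  unswap : (Σ B λ y → Σ A λ x → C x y) → (Σ A λ x → Σ B λ y → C x y)
  unswap (y , x , z) = x , y , z

isContr⇒≃⊤ : ∀ {a ℓ} (A : Set a) → isContr A → A ≃ ⊤ {ℓ}
isContr⇒≃⊤ A (centre , contraction) =
  (λ _ → tt) , λ _ → (centre , refl) , λ { (x , refl) → cong (λ y → y , refl) (contraction x) }

Σ-cong : ∀ {a ℓ} → Extensionality a (lsuc ℓ) →
  {A : Set a} {P Q : A → Set ℓ} → (∀ x → P x ≡ Q x) → Σ A P ≡ Σ A Q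
Σ-cong funext {A} P≡Q = cong (Σ A) (funext P≡Q)

module _ {i : Level} (funext : Extensionality i (lsuc i)) where

  axioms⇒UA : UnitAx i × FlipAx i × ContractAx i → UA i
  axioms⇒UA (unit , flip , contract) A B (f , f-isEquiv) = begin
    A                                  ≡⟨ unit A ⟩
    Σ A (λ _ → ⊤)                      ≡⟨ Σ-cong funext (λ x → sym (contract _ (singleton-isContr (f x)))) ⟩
    (Σ A λ x → Σ B λ y → f x ≡ y)      ≡⟨ flip A B (λ x y → f x ≡ y) ⟩
    Σ B (fib f)                        ≡⟨ Σ-cong funext (λ y → contract _ (f-isEquiv y)) ⟩
    Σ B (λ _ → ⊤)                      ≡⟨ sym (unit B) ⟩
    B                                  ∎
    where open ≡-Reasoning

UA⇒axioms : ∀ {i} → UA i → UnitAx i × FlipAx i × ContractAx i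
UA⇒axioms ua =
    (λ A → ua _ _ (≃-Σ⊤ A))
  , (λ A B C → ua _ _ (Σ-swap-≃ A B C))
  , (λ A A-isContr → ua _ _ (isContr⇒≃⊤ A A-isContr))

theorem4p1 : (funext : ∀ {a b} → Extensionality a b) → (i : Level) →
    (UnitAx i × FlipAx i × ContractAx i) ⇔ UA i
theorem4p1 funext i = mk⇔ (axioms⇒UA funext) UA⇒axioms
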